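{- Let $G$ be a finite simple graph with $n$ vertices. For every natural number $k$, $$n-\Delta(G)\leq\alpha^{(k)}(G)\leq n-\delta(G).$$
   Context: $d(v)$ is the degree of $v$; $\Delta(G)$ and $\delta(G)$ are the maximum and minimum degree. For nonempty $W\subseteq V(G)$, $D_k(W)=\left(\frac{1}{|W|}\sum_{v\in W}d^k(v)\right)^{1/k}$. $W$ is a $\delta_k$-small set if $D_k(W)\leq n-|W|$. $\alpha^{(k)}(G)$ is the maximum number of vertices of a $\delta_k$-small set of $G$. -}

module Defs where

open import Data.Nat using (ℕ; zero; suc; _+_; _*_; _∸_; _^_; _≤_; _⊔_; _⊓_)
open import Data.Nat.Properties using (_≤?_)
open import Data.Bool using (Bool; true; false; if_then_else_)
open import Data.Fin using (Fin; zero; suc)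
open import Data.Fin.Subset using (Subset; inside; outside; ∣_∣)
open import Data.Vec using (lookup; []; _∷_)
open import Data.List using (List; [_]; _++_; map; filter; foldr)
open import Data.Product using (_×_)
open import Relation.Nullary.Decidable using (Dec; _×-dec_)
open import Relation.Binary.PropositionalEquality using (_≡_)

record Graph (n : ℕ) : Set where
  field
    adj    : Fin n → Fin n → Bool
    sym    : ∀ u v → adj u v ≡ adj v u
    irrefl : ∀ v → adj v v ≡ false
open Graph public

sumFin : ∀ {n} → (Fin n → ℕ) → ℕ
sumFin {zero}  f = 0
sumFin {suc n} f = f zero + sumFin (λ i → f (suc i))

foldFin : ∀ {n} → (ℕ → ℕ → ℕ) → ℕ → (Fin n → ℕ) → ℕ
foldFin {zero}  _∙_ e f = e
foldFin {suc n} _∙_ e f = f zero ∙ foldFin _∙_ e (λ i → f (suc i))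

deg : ∀ {n} → Graph n → Fin n → ℕ
deg G v = sumFin (λ u → if adj G v u then 1 else 0)

maxDeg : ∀ {n} → Graph n → ℕ
maxDeg G = foldFin _⊔_ 0 (deg G)

-- δ(G): minimum degree (the start value n is irrelevant for n ≥ 1,
-- since every degree is at most n - 1)
minDeg : ∀ {n} → Graph n → ℕ
minDeg {n} G = foldFin _⊓_ n (deg G)

powerSum : ∀ {n} → Graph n → ℕ → Subset n → ℕ
powerSum G k W = sumFin (λ v → if lookup W v then deg G v ^ k else 0)

-- W is δ_k-small: W nonempty and D_k(W) ≤ n - |W|, where
-- D_k(W) = ((1/|W|) Σ_{v∈W} d(v)^k)^{1/k}.  For k ≥ 1 and |W| ≥ 1 both
-- sides are nonnegative, so this is equivalent to
-- Σ_{v∈W} d(v)^k ≤ |W| · (n - |W|)^k  (note |W| ≤ n, so ∸ is exact).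
Small : ∀ {n} → Graph n → ℕ → Subset n → Set
Small {n} G k W = (1 ≤ ∣ W ∣) × (powerSum G k W ≤ ∣ W ∣ * (n ∸ ∣ W ∣) ^ k)

small? : ∀ {n} (G : Graph n) (k : ℕ) (W : Subset n) → Dec (Small G k W)
small? {n} G k W = (1 ≤? ∣ W ∣) ×-dec (powerSum G k W ≤? ∣ W ∣ * (n ∸ ∣ W ∣) ^ k)

subsets : ∀ n → List (Subset n)
subsets zero    = [ [] ]
subsets (suc n) = map (inside ∷_) (subsets n) ++ map (outside ∷_) (subsets n)

alpha : ∀ {n} → ℕ → Graph n → ℕ
alpha k G = foldr _⊔_ 0 (map ∣_∣ (filter (small? G k) (subsets _)))

module Submission where

-- Write Δ = maxDeg G, δ = minDeg G and, for a vertex set W,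
-- S(W) = Σ_{v∈W} d(v)^k, so that W is δ_k-small iff W ≠ ∅ and
-- S(W) ≤ |W|·(n-|W|)^k.  Every degree lies between δ and Δ, hence
--   |W|·δ^k ≤ S(W) ≤ |W|·Δ^k.
-- Lower bound: if |W| ≤ n-Δ then Δ ≤ n-|W|, so S(W) ≤ |W|·(n-|W|)^k and
-- every nonempty W of size at most n-Δ is small; a set of size exactly n-Δ
-- exists, so α^(k)(G) ≥ n-Δ.
-- Upper bound: if W is small then |W|·δ^k ≤ |W|·(n-|W|)^k; cancelling
-- |W| ≥ 1 and taking k-th roots (k ≥ 1) gives δ ≤ n-|W|, i.e. |W| ≤ n-δ.

open import Defs
open import Data.Nat using (ℕ; zero; suc; _*_; _∸_; _^_; _⊔_; _⊓_; _≤_; z≤n; s≤s; NonZero; >-nonZero)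
open import Data.Nat.Properties
open import Data.Bool using (Bool; true; false; if_then_else_)
open import Data.Fin using (Fin; zero; suc)
open import Data.Fin.Subset using (Subset; inside; outside; ∣_∣)
open import Data.Fin.Subset.Properties using (∣p∣≤n)
open import Data.Vec using (lookup; []; _∷_)
open import Data.List using (List; filter; foldr; map)
open import Data.List.Membership.Propositional using (_∈_)
open import Data.List.Membership.Propositional.Properties using (∈-filter⁺; ∈-map⁺; ∈-++⁺ˡ; ∈-++⁺ʳ)
open import Data.List.Relation.Unary.All as All using (All; []; _∷_)
open import Data.List.Relation.Unary.All.Properties using (all-filter; map⁺)
open import Data.List.Relation.Unary.Any using (here; there)
open import Data.Product using (_×_; _,_)
open import Relation.Binary.PropositionalEquality using (_≡_; refl; subst) renaming (sym to ≡-sym)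

foldMax-upper : ∀ {n} (f : Fin n → ℕ) (v : Fin n) → f v ≤ foldFin _⊔_ 0 f
foldMax-upper f zero    = m≤m⊔n _ _
foldMax-upper f (suc v) = ≤-trans (foldMax-upper (λ i → f (suc i)) v) (m≤n⊔m _ _)

foldMax-least : ∀ {n} (f : Fin n → ℕ) b → (∀ v → f v ≤ b) → foldFin _⊔_ 0 f ≤ b
foldMax-least {zero}  f b h = z≤n
foldMax-least {suc n} f b h = ⊔-lub (h zero) (foldMax-least (λ i → f (suc i)) b (λ v → h (suc v)))

foldMin-lower : ∀ {n} e (f : Fin n → ℕ) (v : Fin n) → foldFin _⊓_ e f ≤ f v
foldMin-lower e f zero    = m⊓n≤m _ _
foldMin-lower e f (suc v) = ≤-trans (m⊓n≤n _ _) (foldMin-lower e (λ i → f (suc i)) v)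

count≤n : ∀ {n} (p : Fin n → Bool) → sumFin (λ u → if p u then 1 else 0) ≤ n
count≤n {zero}  p = z≤n
count≤n {suc n} p with p zero
... | true  = s≤s (count≤n (λ i → p (suc i)))
... | false = m≤n⇒m≤1+n (count≤n (λ i → p (suc i)))

maxDeg≤n : ∀ {n} (G : Graph n) → maxDeg G ≤ n
maxDeg≤n G = foldMax-least (deg G) _ (λ v → count≤n (adj G v))

subsetSum≤ : ∀ {n} (W : Subset n) (f : Fin n → ℕ) c → (∀ v → f v ≤ c) →
  sumFin (λ v → if lookup W v then f v else 0) ≤ ∣ W ∣ * c
subsetSum≤ []          f c h = z≤n
subsetSum≤ (true ∷ W)  f c h = +-mono-≤ (h zero) (subsetSum≤ W (λ i → f (suc i)) c (λ v → h (suc v)))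
subsetSum≤ (false ∷ W) f c h = subsetSum≤ W (λ i → f (suc i)) c (λ v → h (suc v))

subsetSum≥ : ∀ {n} (W : Subset n) (f : Fin n → ℕ) c → (∀ v → c ≤ f v) →
  ∣ W ∣ * c ≤ sumFin (λ v → if lookup W v then f v else 0)
subsetSum≥ []          f c h = z≤n
subsetSum≥ (true ∷ W)  f c h = +-mono-≤ (h zero) (subsetSum≥ W (λ i → f (suc i)) c (λ v → h (suc v)))
subsetSum≥ (false ∷ W) f c h = subsetSum≥ W (λ i → f (suc i)) c (λ v → h (suc v))

powerSum≤ : ∀ {n} (G : Graph n) k (W : Subset n) → powerSum G k W ≤ ∣ W ∣ * maxDeg G ^ k
powerSum≤ G k W = subsetSum≤ W _ _ (λ v → ^-monoˡ-≤ k (foldMax-upper (deg G) v))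

powerSum≥ : ∀ {n} (G : Graph n) k (W : Subset n) → ∣ W ∣ * minDeg G ^ k ≤ powerSum G k W
powerSum≥ {n} G k W = subsetSum≥ W _ _ (λ v → ^-monoˡ-≤ k (foldMin-lower n (deg G) v))

^-reflectˡ-≤ : ∀ k .{{_ : NonZero k}} {a b} → a ^ k ≤ b ^ k → a ≤ b
^-reflectˡ-≤ k aᵏ≤bᵏ = ≮⇒≥ (λ b<a → <⇒≱ (^-monoˡ-< k b<a) aᵏ≤bᵏ)

swap-∸ : ∀ {a b} n → b ≤ n → a ≤ n ∸ b → b ≤ n ∸ a
swap-∸ {a} {b} n b≤n a≤n∸b = subst (_≤ n ∸ a) (m∸[m∸n]≡n b≤n) (∸-monoʳ-≤ n a≤n∸b)

∈-subsets : ∀ {n} (W : Subset n) → W ∈ subsets n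
∈-subsets []                  = here refl
∈-subsets {suc n} (true ∷ W)  = ∈-++⁺ˡ (∈-map⁺ (inside ∷_) (∈-subsets W))
∈-subsets {suc n} (false ∷ W) = ∈-++⁺ʳ (map (inside ∷_) (subsets n)) (∈-map⁺ (outside ∷_) (∈-subsets W))

foldr⊔-upper : ∀ {x} {xs : List ℕ} → x ∈ xs → x ≤ foldr _⊔_ 0 xs
foldr⊔-upper (here refl) = m≤m⊔n _ _
foldr⊔-upper (there x∈)  = ≤-trans (foldr⊔-upper x∈) (m≤n⊔m _ _)

foldr⊔-least : ∀ {xs : List ℕ} b → All (_≤ b) xs → foldr _⊔_ 0 xs ≤ b
foldr⊔-least b []         = z≤n
foldr⊔-least b (p ∷ ps)   = ⊔-lub p (foldr⊔-least b ps)

small≤alpha : ∀ {n} (G : Graph n) k W → Small G k W → ∣ W ∣ ≤ alpha k G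
small≤alpha G k W small = foldr⊔-upper (∈-map⁺ ∣_∣ (∈-filter⁺ (small? G k) (∈-subsets W) small))

alpha≤ : ∀ {n} (G : Graph n) k b → (∀ W → Small G k W → ∣ W ∣ ≤ b) → alpha k G ≤ b
alpha≤ G k b bound = foldr⊔-least b (map⁺ (All.map (λ {W} → bound W) (all-filter (small? G k) (subsets _))))

initialSegment : ∀ n → ℕ → Subset n
initialSegment zero    m       = []
initialSegment (suc n) zero    = outside ∷ initialSegment n 0
initialSegment (suc n) (suc m) = inside ∷ initialSegment n m

∣initialSegment∣ : ∀ n m → m ≤ n → ∣ initialSegment n m ∣ ≡ m
∣initialSegment∣ zero    zero    _         = refl
∣initialSegment∣ (suc n) zero    _         = ∣initialSegment∣ n zero z≤n
∣initialSegment∣ (suc n) (suc m) (s≤s m≤n) rewrite ∣initialSegment∣ n m m≤n = refl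

small-if-≤n∸Δ : ∀ {n} (G : Graph n) k (W : Subset n) →
  1 ≤ ∣ W ∣ → ∣ W ∣ ≤ n ∸ maxDeg G → Small G k W
small-if-≤n∸Δ {n} G k W nonempty |W|≤n∸Δ = nonempty , (begin
  powerSum G k W            ≤⟨ powerSum≤ G k W ⟩
  ∣ W ∣ * maxDeg G ^ k      ≤⟨ *-monoʳ-≤ ∣ W ∣ (^-monoˡ-≤ k Δ≤n∸|W|) ⟩
  ∣ W ∣ * (n ∸ ∣ W ∣) ^ k   ∎)
  where
  open ≤-Reasoning
  Δ≤n∸|W| : maxDeg G ≤ n ∸ ∣ W ∣
  Δ≤n∸|W| = swap-∸ n (maxDeg≤n G) |W|≤n∸Δ

≤n∸Δ⇒≤alpha : ∀ {n} (G : Graph n) k m → m ≤ n ∸ maxDeg G → m ≤ alpha k G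
≤n∸Δ⇒≤alpha G k zero    _      = z≤n
≤n∸Δ⇒≤alpha {n} G k (suc m) m≤n∸Δ =
  subst (_≤ alpha k G) |W|≡ (small≤alpha G k W
    (small-if-≤n∸Δ G k W (subst (1 ≤_) (≡-sym |W|≡) (s≤s z≤n))
                         (subst (_≤ n ∸ maxDeg G) (≡-sym |W|≡) m≤n∸Δ)))
  where
  W = initialSegment n (suc m)
  |W|≡ : ∣ W ∣ ≡ suc m
  |W|≡ = ∣initialSegment∣ n (suc m) (≤-trans m≤n∸Δ (m∸n≤m n (maxDeg G)))

small⇒≤n∸δ : ∀ {n} (G : Graph n) k → 1 ≤ k → ∀ W → Small G k W → ∣ W ∣ ≤ n ∸ minDeg G
small⇒≤n∸δ {n} G k 1≤k W (1≤|W| , S≤) = swap-∸ n (∣p∣≤n W) δ≤n∸|W|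
  where
  instance
    |W|≢0 : NonZero ∣ W ∣
    |W|≢0 = >-nonZero 1≤|W|
    k≢0 : NonZero k
    k≢0 = >-nonZero 1≤k
  δ≤n∸|W| : minDeg G ≤ n ∸ ∣ W ∣
  δ≤n∸|W| = ^-reflectˡ-≤ k (*-cancelˡ-≤ ∣ W ∣ (≤-trans (powerSum≥ G k W) S≤))

proposition5p4 : (n : ℕ) (G : Graph n) (k : ℕ) → 1 ≤ n → 1 ≤ k →
    (n ∸ maxDeg G ≤ alpha k G) × (alpha k G ≤ n ∸ minDeg G)
proposition5p4 n G k _ 1≤k =
  ≤n∸Δ⇒≤alpha G k (n ∸ maxDeg G) ≤-refl , alpha≤ G k (n ∸ minDeg G) (small⇒≤n∸δ G k 1≤k)
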